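{- Let $G$ be a simple undirected graph with $n$ vertices ($n\in\mathbb{N}$). Then $G$ is a tree if and only if every coding sequence $\beta(G,n)$ of $G$ is a basis of the vector space $\mathbb{Z}_2^{n-1}$ over the field $\mathbb{Z}_2$.
   Context: Coding sequences: let $G=(V,E)$ be a simple undirected graph with $n$ vertices. Choose a labeling of the vertices $V=\{v_0,v_1,\ldots,v_{n-1}\}$ (i.e. a bijection from $V$ to $\{0,\dots,n-1\}$; vertex $v_i$ is also referred to as $10^i$). For an edge $e=v_iv_j$ with $i>j$ define $f^\#(e)=(x_1,\ldots,x_{n-1})\in\mathbb{Z}_2^{n-1}$ by $x_k=1$ iff $n-i\le k\le n-j-1$, and $x_k=0$ otherwise (equivalently, $x_k=1$ iff the $(n-k)$-th decimal digit from the right of $10^i-10^j$ is $9$). The coding sequence $\beta(G,n)$ associated with this labeling is the set $\{f^\#(e): e\in E\}$ (the empty set if $E=\emptyset$). Different labelings may give different coding sequences; "every coding sequence" means the one obtained from any labeling. -}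

module Defs where

open import Data.Nat using (ℕ; zero; suc; _∸_; _<_; _≤ᵇ_)
open import Data.Fin using (Fin; toℕ)
open import Data.Bool using (Bool; true; false; _∧_; _xor_)
open import Data.Vec using (Vec; tabulate; zipWith; replicate; map)
open import Data.List using (List; []; _∷_; length) renaming (map to mapL)
open import Data.List.Relation.Unary.All using (All)
open import Data.List.Relation.Unary.Unique.Propositional using (Unique)
open import Data.Product using (Σ; ∃; ∃-syntax; _×_; _,_; proj₁; proj₂)
open import Data.Unit using (⊤)
open import Data.Empty using (⊥)
open import Relation.Binary.PropositionalEquality using (_≡_)
open import Relation.Nullary using (¬_; Dec)
open import Function.Bundles using (_⤖_; Bijection)
open import Level using (0ℓ)

record SimpleGraph (n : ℕ) : Set₁ where
  field
    Adj     : Fin n → Fin n → Set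
    sym     : ∀ {u v} → Adj u v → Adj v u
    irrefl  : ∀ {u} → ¬ Adj u u
    dec     : ∀ u v → Dec (Adj u v)

open SimpleGraph public

Chain : ∀ {n} → SimpleGraph n → List (Fin n) → Set
Chain G []            = ⊤
Chain G (u ∷ [])      = ⊤
Chain G (u ∷ v ∷ vs)  = Adj G u v × Chain G (v ∷ vs)

head? : ∀ {n} → List (Fin n) → Fin n → Set
head? []      x = ⊥
head? (u ∷ _) x = u ≡ x

last? : ∀ {n} → List (Fin n) → Fin n → Set
last? []           x = ⊥
last? (u ∷ [])     x = u ≡ x
last? (u ∷ v ∷ vs) x = last? (v ∷ vs) x

Walk : ∀ {n} → SimpleGraph n → Fin n → Fin n → List (Fin n) → Set
Walk G u v ws = head? ws u × last? ws v × Chain G ws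

Connected : ∀ {n} → SimpleGraph n → Set
Connected {n} G = ∀ (u v : Fin n) → ∃[ ws ] Walk G u v ws

IsCycle : ∀ {n} → SimpleGraph n → List (Fin n) → Set
IsCycle G vs =
  2 < length vs × Unique vs × Chain G vs ×
  Σ (Fin _) λ a → Σ (Fin _) λ b → head? vs a × last? vs b × Adj G b a

Acyclic : ∀ {n} → SimpleGraph n → Set
Acyclic {n} G = ∀ (vs : List (Fin n)) → ¬ IsCycle G vs

IsTree : ∀ {n} → SimpleGraph n → Set
IsTree G = Connected G × Acyclic G

-- The vector space ℤ₂^m as Vec Bool m (true = 1, xor = addition).

Z2^ : ℕ → Set
Z2^ m = Vec Bool m

zeroV : ∀ {m} → Z2^ m
zeroV = replicate _ false

_+V_ : ∀ {m} → Z2^ m → Z2^ m → Z2^ m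
_+V_ = zipWith _xor_

_•_ : ∀ {m} → Bool → Z2^ m → Z2^ m
c • v = map (c ∧_) v

lincomb : ∀ {m} → List (Bool × Z2^ m) → Z2^ m
lincomb []             = zeroV
lincomb ((c , v) ∷ cs) = (c • v) +V lincomb cs

VSet : ℕ → Set₁
VSet m = Z2^ m → Set

LinearlyIndependent : ∀ {m} → VSet m → Set
LinearlyIndependent {m} S =
  ∀ (cs : List (Bool × Z2^ m)) →
    Unique (mapL proj₂ cs) → All S (mapL proj₂ cs) →
    lincomb cs ≡ zeroV → All (λ p → proj₁ p ≡ false) cs

Spans : ∀ {m} → VSet m → Set
Spans {m} S =
  ∀ (x : Z2^ m) → ∃[ cs ] (All S (mapL proj₂ cs) × lincomb cs ≡ x)

IsBasis : ∀ {m} → VSet m → Set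
IsBasis S = LinearlyIndependent S × Spans S

-- f#(v_i v_j) for i > j: the vector (x₁,…,x_{n-1}) with x_k = 1 iff
-- n-i ≤ k ≤ n-j-1.  Coordinate x_k is stored at position p = k-1.
fSharp : (n : ℕ) → Fin n → Fin n → Z2^ (n ∸ 1)
fSharp n i j = tabulate λ p →
  ((n ∸ toℕ i) ≤ᵇ suc (toℕ p)) ∧ (suc (toℕ p) ≤ᵇ (n ∸ suc (toℕ j)))

Labeling : ℕ → Set
Labeling n = Fin n ⤖ Fin n

codingSeq : ∀ {n} → SimpleGraph n → Labeling n → VSet (n ∸ 1)
codingSeq {n} G σ x =
  ∃[ u ] ∃[ v ] (Adj G u v × toℕ (f v) < toℕ (f u) × x ≡ fSharp n (f u) (f v))
  where f = Bijection.to σ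

module Submission where

-- Fix a labeling; let threshold k ∈ ℤ₂^m have exactly its last k coordinates
-- equal to 1.  Then f#(ab) = threshold (label a) + threshold (label b), a
-- vector edgeVec a b defined for every vertex pair.  Two tools carry the
-- proof: the edge vectors along a walk from a to b sum to edgeVec a b, and
-- each vertex set C has a linear "cut" functional with
-- cut C (edgeVec a b) = C a + C b (a telescoping sum).  Hence: connected ⇒
-- spanning (unit vectors are edgeVecs of consecutively labelled vertices);
-- spanning ⇒ connected (the cut of a component vanishes on β); independent
-- ⇒ acyclic (a cycle sums to 0); tree ⇒ independent (the cut of one side of
-- an edge ab detects f#(ab) alone).

open import Defs hiding (sym)
open import Data.Nat
  using (ℕ; zero; suc; _∸_; _<_; _≤_; _≤ᵇ_; _≤?_; z≤n; s≤s; s≤s⁻¹; _≤′_; ≤′-refl; ≤′-step)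
open import Data.Nat.Properties
  using (<⇒≤; <⇒≱; ≰⇒>; ≤-trans; ≤⇒≤′; <-cmp; m∸n≤m; m∸[m∸n]≡n; ∸-monoʳ-≤; +-∸-assoc)
open import Data.Fin using (Fin; toℕ; fromℕ<) renaming (zero to fzero; suc to fsuc)
open import Data.Fin.Properties using (toℕ<n; toℕ-fromℕ<; toℕ-injective; any?; pigeonhole)
  renaming (_≟_ to _≟ᶠ_; <-irrefl to <ᶠ-irrefl)
open import Data.Bool using (Bool; true; false; _∧_; _xor_)
open import Data.Bool.Properties
  using (xor-assoc; xor-comm; xor-same; xor-identityˡ; xor-identityʳ; ∧-identityʳ; ∧-zeroʳ;
         ∧-distribʳ-xor; xor-∧-commutativeRing; ¬-not)
open import Data.Vec using ([]; _∷_; tabulate; lookup)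
open import Data.Vec.Properties
  using (lookup-zipWith; lookup∘tabulate; tabulate∘lookup; tabulate-cong; lookup-replicate;
         map-id; map-const; zipWith-assoc; zipWith-identityˡ; zipWith-comm)
open import Data.List using (List; []; _∷_; _++_; length) renaming (map to mapL; lookup to lookupL)
open import Data.List.Membership.Propositional using (_∈_; _∉_)
open import Data.List.Membership.Propositional.Properties using (∈-lookup; ∈-map⁺)
open import Data.List.Relation.Unary.Any using (here; there)
open import Data.List.Relation.Unary.All using (All; []; _∷_) renaming (lookup to lookupAll)
open import Data.List.Relation.Unary.All.Properties using (¬Any⇒All¬; ++⁺)
import Data.List.Relation.Unary.All as All
open import Data.List.Properties using (map-++)
open import Data.List.Relation.Unary.Unique.Propositional using (Unique; []; _∷_)
open import Data.List.Relation.Unary.Unique.Propositional.Properties using (Unique[x∷xs]⇒x∉xs)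
open import Data.Product using (∃-syntax; _×_; _,_; proj₁; proj₂)
open import Data.Sum using (_⊎_; inj₁; inj₂)
open import Data.Unit using (tt)
open import Function using (_∘_)
open import Function.Bundles using (Bijection; Surjection)
open import Function.Construct.Identity using (⤖-id)
open import Relation.Binary.Definitions using (tri<; tri≈; tri>)
open import Relation.Binary.PropositionalEquality
  using (_≡_; _≢_; refl; sym; trans; cong; cong₂; subst; module ≡-Reasoning)
open import Relation.Nullary using (¬_; Dec; yes; no; does; contradiction; ¬?)
open import Relation.Nullary.Decidable using (dec-true; dec-false; _⊎-dec_; _×-dec_)

open import Algebra.Bundles using (CommutativeRing)
open import Algebra.Properties.CommutativeSemigroup
  (CommutativeRing.+-commutativeSemigroup xor-∧-commutativeRing)
  using () renaming (interchange to xor-interchange)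

open ≡-Reasoning

xor-cancel-middle : ∀ a b c → (a xor b) xor (b xor c) ≡ a xor c
xor-cancel-middle a b c = begin
  (a xor b) xor (b xor c)  ≡⟨ xor-assoc a b (b xor c) ⟩
  a xor (b xor (b xor c))  ≡⟨ cong (a xor_) (sym (xor-assoc b b c)) ⟩
  a xor ((b xor b) xor c)  ≡⟨ cong (λ z → a xor (z xor c)) (xor-same b) ⟩
  a xor c                  ∎

≤ᵇ-true : ∀ {a q} → a ≤ q → (a ≤ᵇ q) ≡ true
≤ᵇ-true {a} {q} = dec-true (a ≤? q)

≤ᵇ-false : ∀ {a q} → q < a → (a ≤ᵇ q) ≡ false
≤ᵇ-false {a} {q} q<a = dec-false (a ≤? q) (<⇒≱ q<a)

suc-≤ᵇ : ∀ a q → (suc a ≤ᵇ suc q) ≡ (a ≤ᵇ q)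
suc-≤ᵇ zero    q = refl
suc-≤ᵇ (suc a) q = refl

interval-indicator : ∀ {A B} → A ≤ B → ∀ q →
  ((A ≤ᵇ q) ∧ (suc q ≤ᵇ B)) ≡ ((A ≤ᵇ q) xor (B ≤ᵇ q))
interval-indicator {A} {B} A≤B q with B ≤? q
... | yes B≤q rewrite ≤ᵇ-true (≤-trans A≤B B≤q) | ≤ᵇ-false {suc q} {B} (s≤s B≤q) | ≤ᵇ-true B≤q =
  refl
... | no  B≰q rewrite ≤ᵇ-true {suc q} {B} (≰⇒> B≰q) | ≤ᵇ-false {B} {q} (≰⇒> B≰q) =
  trans (∧-identityʳ (A ≤ᵇ q)) (sym (xor-identityʳ (A ≤ᵇ q)))

vec-ext : ∀ {m} {x y : Z2^ m} → (∀ i → lookup x i ≡ lookup y i) → x ≡ y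
vec-ext {x = x} {y} h = trans (sym (tabulate∘lookup x)) (trans (tabulate-cong h) (tabulate∘lookup y))

+V-assoc : ∀ {m} (x y z : Z2^ m) → (x +V y) +V z ≡ x +V (y +V z)
+V-assoc = zipWith-assoc xor-assoc

+V-comm : ∀ {m} (x y : Z2^ m) → x +V y ≡ y +V x
+V-comm = zipWith-comm xor-comm

+V-identityˡ : ∀ {m} (x : Z2^ m) → zeroV +V x ≡ x
+V-identityˡ = zipWith-identityˡ xor-identityˡ

+V-self : ∀ {m} (x : Z2^ m) → x +V x ≡ zeroV
+V-self []       = refl
+V-self (a ∷ x) = cong₂ _∷_ (xor-same a) (+V-self x)

+V-cancel-middle : ∀ {m} (x y z : Z2^ m) → (x +V y) +V (y +V z) ≡ x +V z
+V-cancel-middle []      []      []      = refl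
+V-cancel-middle (a ∷ x) (b ∷ y) (c ∷ z) =
  cong₂ _∷_ (xor-cancel-middle a b c) (+V-cancel-middle x y z)

•-identity : ∀ {m} (x : Z2^ m) → true • x ≡ x
•-identity = map-id

•-zeroˡ : ∀ {m} (x : Z2^ m) → false • x ≡ zeroV
•-zeroˡ x = map-const x false

•-zeroʳ : ∀ {m} c → c • zeroV {m} ≡ zeroV
•-zeroʳ {zero}  c = refl
•-zeroʳ {suc m} c = cong₂ _∷_ (∧-zeroʳ c) (•-zeroʳ c)

-- The standard bilinear form x · y = Σᵢ xᵢ yᵢ; every linear functional
-- used below is of the form x ↦ x · g.
_·_ : ∀ {m} → Z2^ m → Z2^ m → Bool
[]      · []      = false
(a ∷ x) · (b ∷ y) = (a ∧ b) xor (x · y)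

·-+ : ∀ {m} (x y g : Z2^ m) → (x +V y) · g ≡ (x · g) xor (y · g)
·-+ []      []      []      = refl
·-+ (a ∷ x) (b ∷ y) (c ∷ g) = begin
  ((a xor b) ∧ c) xor ((x +V y) · g)
    ≡⟨ cong₂ _xor_ (∧-distribʳ-xor c a b) (·-+ x y g) ⟩
  ((a ∧ c) xor (b ∧ c)) xor ((x · g) xor (y · g))
    ≡⟨ xor-interchange (a ∧ c) (b ∧ c) (x · g) (y · g) ⟩
  ((a ∧ c) xor (x · g)) xor ((b ∧ c) xor (y · g))
    ∎

·-zeroˡ : ∀ {m} (g : Z2^ m) → zeroV · g ≡ false
·-zeroˡ []      = refl
·-zeroˡ (b ∷ g) = ·-zeroˡ g

·-• : ∀ {m} c (x g : Z2^ m) → (c • x) · g ≡ c ∧ (x · g)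
·-• true  x g = cong (_· g) (•-identity x)
·-• false x g = trans (cong (_· g) (•-zeroˡ x)) (·-zeroˡ g)

InSpan : ∀ {m} → VSet m → Z2^ m → Set
InSpan {m} S x = ∃[ cs ] (All S (mapL proj₂ cs) × lincomb cs ≡ x)

lincomb-++ : ∀ {m} (cs ds : List (Bool × Z2^ m)) → lincomb (cs ++ ds) ≡ lincomb cs +V lincomb ds
lincomb-++ []             ds = sym (+V-identityˡ (lincomb ds))
lincomb-++ ((c , v) ∷ cs) ds =
  trans (cong ((c • v) +V_) (lincomb-++ cs ds)) (sym (+V-assoc (c • v) (lincomb cs) (lincomb ds)))

module _ {m} {S : VSet m} where

  span-zero : InSpan S zeroV
  span-zero = [] , [] , refl

  span-+ : ∀ {x y} → InSpan S x → InSpan S y → InSpan S (x +V y)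
  span-+ (cs , cs∈S , refl) (ds , ds∈S , refl) =
    cs ++ ds , subst (All S) (sym (map-++ proj₂ cs ds)) (++⁺ cs∈S ds∈S) , lincomb-++ cs ds

  span-• : ∀ c {x} → InSpan S x → InSpan S (c • x)
  span-• true  {x} x∈ = subst (InSpan S) (sym (•-identity x)) x∈
  span-• false {x} _  = subst (InSpan S) (sym (•-zeroˡ x)) span-zero

  span-lincomb : ∀ cs → All (InSpan S) (mapL proj₂ cs) → InSpan S (lincomb cs)
  span-lincomb []             []          = span-zero
  span-lincomb ((c , v) ∷ cs) (v∈ ∷ cs∈) = span-+ (span-• c v∈) (span-lincomb cs cs∈)

unit : ∀ {m} → Fin m → Z2^ m
unit fzero    = true ∷ zeroV
unit (fsuc p) = false ∷ unit p

IsUnit : ∀ {m} → VSet m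
IsUnit v = ∃[ p ] v ≡ unit p

pad : ∀ {m} → Bool × Z2^ m → Bool × Z2^ (suc m)
pad (d , v) = d , false ∷ v

unitExpansion : ∀ {m} → Z2^ m → List (Bool × Z2^ m)
unitExpansion []      = []
unitExpansion (c ∷ x) = (c , unit fzero) ∷ mapL pad (unitExpansion x)

lincomb-pad : ∀ {m} (cs : List (Bool × Z2^ m)) → lincomb (mapL pad cs) ≡ false ∷ lincomb cs
lincomb-pad []             = refl
lincomb-pad ((d , v) ∷ cs) =
  trans (cong ((d • (false ∷ v)) +V_) (lincomb-pad cs))
        (cong (_∷ ((d • v) +V lincomb cs)) (trans (xor-identityʳ (d ∧ false)) (∧-zeroʳ d)))

lincomb-unitExpansion : ∀ {m} (x : Z2^ m) → lincomb (unitExpansion x) ≡ x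
lincomb-unitExpansion []      = refl
lincomb-unitExpansion (c ∷ x) = begin
  (c • unit fzero) +V lincomb (mapL pad (unitExpansion x))
    ≡⟨ cong ((c • unit fzero) +V_) (lincomb-pad (unitExpansion x)) ⟩
  (c • unit fzero) +V (false ∷ lincomb (unitExpansion x))
    ≡⟨ cong (λ y → (c • unit fzero) +V (false ∷ y)) (lincomb-unitExpansion x) ⟩
  ((c ∧ true) xor false) ∷ ((c • zeroV) +V x)
    ≡⟨ cong₂ _∷_ (trans (xor-identityʳ (c ∧ true)) (∧-identityʳ c))
                 (trans (cong (_+V x) (•-zeroʳ c)) (+V-identityˡ x)) ⟩
  c ∷ x
    ∎

unitExpansion-units : ∀ {m} (x : Z2^ m) → All IsUnit (mapL proj₂ (unitExpansion x))
unitExpansion-units []      = []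
unitExpansion-units (c ∷ x) = (fzero , refl) ∷ padded (unitExpansion x) (unitExpansion-units x)
  where
  padded : ∀ {m} (cs : List (Bool × Z2^ m)) →
    All IsUnit (mapL proj₂ cs) → All IsUnit (mapL proj₂ (mapL pad cs))
  padded []       []              = []
  padded (_ ∷ cs) ((p , refl) ∷ us) = (fsuc p , refl) ∷ padded cs us

units-span : ∀ {m} (S : VSet m) → (∀ p → InSpan S (unit p)) → Spans S
units-span S units x =
  subst (InSpan S) (lincomb-unitExpansion x)
        (span-lincomb (unitExpansion x) (All.map (λ { (p , refl) → units p }) (unitExpansion-units x)))

-- Threshold vectors.  threshold k ∈ ℤ₂^m has exactly its last k
-- coordinates equal to 1 (for k ≤ m).  Every f#(e) is a sum of two of
-- them, and the unit vectors are sums of two consecutive ones.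

halfLine : ∀ {m} → ℕ → Z2^ m
halfLine a = tabulate λ q → a ≤ᵇ toℕ q

threshold : ∀ {m} → ℕ → Z2^ m
threshold {m} k = halfLine (m ∸ k)

differences : ∀ {m} → (ℕ → Bool) → Z2^ m
differences h = tabulate λ q → h (toℕ q) xor h (suc (toℕ q))

lookup-threshold+ : ∀ {m} k l (q : Fin m) →
  lookup (threshold k +V threshold l) q ≡ ((m ∸ k) ≤ᵇ toℕ q) xor ((m ∸ l) ≤ᵇ toℕ q)
lookup-threshold+ k l q =
  trans (lookup-zipWith _xor_ q (threshold k) (threshold l))
        (cong₂ _xor_ (lookup∘tabulate _ q) (lookup∘tabulate _ q))

fSharp-threshold : ∀ {m} (i j : Fin (suc m)) → toℕ j < toℕ i →
  fSharp (suc m) i j ≡ threshold (toℕ i) +V threshold (toℕ j)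
fSharp-threshold {m} i j j<i = vec-ext λ q → begin
  lookup (fSharp (suc m) i j) q
    ≡⟨ lookup∘tabulate _ q ⟩
  ((suc m ∸ a) ≤ᵇ suc (toℕ q)) ∧ (suc (toℕ q) ≤ᵇ (m ∸ b))
    ≡⟨ cong (λ z → (z ≤ᵇ suc (toℕ q)) ∧ (suc (toℕ q) ≤ᵇ (m ∸ b))) (+-∸-assoc 1 a≤m) ⟩
  (suc (m ∸ a) ≤ᵇ suc (toℕ q)) ∧ (suc (toℕ q) ≤ᵇ (m ∸ b))
    ≡⟨ cong (_∧ (suc (toℕ q) ≤ᵇ (m ∸ b))) (suc-≤ᵇ (m ∸ a) (toℕ q)) ⟩
  ((m ∸ a) ≤ᵇ toℕ q) ∧ (suc (toℕ q) ≤ᵇ (m ∸ b))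
    ≡⟨ interval-indicator (∸-monoʳ-≤ m (<⇒≤ j<i)) (toℕ q) ⟩
  ((m ∸ a) ≤ᵇ toℕ q) xor ((m ∸ b) ≤ᵇ toℕ q)
    ≡⟨ sym (lookup-threshold+ a b q) ⟩
  lookup (threshold a +V threshold b) q
    ∎
  where
  a b : ℕ
  a = toℕ i
  b = toℕ j
  a≤m : a ≤ m
  a≤m = s≤s⁻¹ (toℕ<n i)

lookup-unit : ∀ {m} (p q : Fin m) →
  lookup (unit p) q ≡ (toℕ p ≤ᵇ toℕ q) xor (suc (toℕ p) ≤ᵇ toℕ q)
lookup-unit fzero    fzero    = refl
lookup-unit fzero    (fsuc q) = lookup-replicate q false
lookup-unit (fsuc p) fzero    = refl
lookup-unit (fsuc p) (fsuc q) =
  trans (lookup-unit p q)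
        (sym (cong₂ _xor_ (suc-≤ᵇ (toℕ p) (toℕ q)) (suc-≤ᵇ (suc (toℕ p)) (toℕ q))))

unit-threshold : ∀ {m} (p : Fin m) → unit p ≡ threshold (m ∸ toℕ p) +V threshold (m ∸ suc (toℕ p))
unit-threshold {m} p = vec-ext λ q → begin
  lookup (unit p) q
    ≡⟨ lookup-unit p q ⟩
  (toℕ p ≤ᵇ toℕ q) xor (suc (toℕ p) ≤ᵇ toℕ q)
    ≡⟨ sym (cong₂ (λ k l → (k ≤ᵇ toℕ q) xor (l ≤ᵇ toℕ q))
                  (m∸[m∸n]≡n (<⇒≤ (toℕ<n p))) (m∸[m∸n]≡n (toℕ<n p))) ⟩
  ((m ∸ (m ∸ toℕ p)) ≤ᵇ toℕ q) xor ((m ∸ (m ∸ suc (toℕ p))) ≤ᵇ toℕ q)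
    ≡⟨ sym (lookup-threshold+ (m ∸ toℕ p) (m ∸ suc (toℕ p)) q) ⟩
  lookup (threshold (m ∸ toℕ p) +V threshold (m ∸ suc (toℕ p))) q
    ∎

telescope : ∀ {m} a (h : ℕ → Bool) → a ≤ m → halfLine {m} a · differences h ≡ h a xor h m
telescope {zero}  zero    h z≤n       = sym (xor-same (h 0))
telescope {suc m} zero    h z≤n       = begin
  (h 0 xor h 1) xor (halfLine {m} 0 · differences (h ∘ suc))
    ≡⟨ cong ((h 0 xor h 1) xor_) (telescope 0 (h ∘ suc) z≤n) ⟩
  (h 0 xor h 1) xor (h 1 xor h (suc m))
    ≡⟨ xor-cancel-middle (h 0) (h 1) (h (suc m)) ⟩
  h 0 xor h (suc m)
    ∎
telescope {suc m} (suc a) h (s≤s a≤m) =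
  trans (cong (_· differences {m} (h ∘ suc)) (tabulate-cong λ q → suc-≤ᵇ a (toℕ q)))
        (telescope a (h ∘ suc) a≤m)

evaluate : ∀ {m} → (Z2^ m → Bool) → List (Bool × Z2^ m) → Bool
evaluate φ []             = false
evaluate φ ((c , v) ∷ cs) = (c ∧ φ v) xor evaluate φ cs

·-lincomb : ∀ {m} (g : Z2^ m) cs → lincomb cs · g ≡ evaluate (_· g) cs
·-lincomb g []             = ·-zeroˡ g
·-lincomb g ((c , v) ∷ cs) =
  trans (·-+ (c • v) (lincomb cs) g) (cong₂ _xor_ (·-• c v g) (·-lincomb g cs))

evaluate-vanishing : ∀ {m} (φ : Z2^ m → Bool) cs →
  (∀ {v} → v ∈ mapL proj₂ cs → φ v ≡ false) → evaluate φ cs ≡ false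
evaluate-vanishing φ []             _    = refl
evaluate-vanishing φ ((c , v) ∷ cs) vanishes =
  cong₂ _xor_ (trans (cong (c ∧_) (vanishes (here refl))) (∧-zeroʳ c))
              (evaluate-vanishing φ cs (vanishes ∘ there))

evaluate-isolates : ∀ {m} (φ : Z2^ m → Bool) cs {c v} → Unique (mapL proj₂ cs) → (c , v) ∈ cs →
  φ v ≡ true → (∀ {w} → w ∈ mapL proj₂ cs → φ w ≡ true → w ≡ v) → evaluate φ cs ≡ c
evaluate-isolates φ ((c , v) ∷ cs) (v∉cs ∷ _) (here refl) φv only =
  trans (cong₂ _xor_ (trans (cong (c ∧_) φv) (∧-identityʳ c)) (evaluate-vanishing φ cs φ-off))
        (xor-identityʳ c)
  where
  φ-off : ∀ {w} → w ∈ mapL proj₂ cs → φ w ≡ false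
  φ-off w∈ = ¬-not λ φw → lookupAll v∉cs w∈ (sym (only (there w∈) φw))
evaluate-isolates φ ((c′ , v′) ∷ cs) (v′∉cs ∷ u) (there cv∈) φv only =
  trans (cong (_xor evaluate φ cs) (trans (cong (c′ ∧_) φv′) (∧-zeroʳ c′)))
        (evaluate-isolates φ cs u cv∈ φv (only ∘ there))
  where
  φv′ : φ v′ ≡ false
  φv′ = ¬-not λ φw → lookupAll v′∉cs (∈-map⁺ proj₂ cv∈) (only (here refl) φw)

-- Walks, paths and reachability in a finite simple graph.

lookup-injective : ∀ {A : Set} {xs : List A} → Unique xs →
  ∀ {i j} → lookupL xs i ≡ lookupL xs j → i ≡ j
lookup-injective (_     ∷ _) {fzero}  {fzero}  _ = refl
lookup-injective (x∉xs ∷ _) {fzero}  {fsuc j} e = contradiction e (lookupAll x∉xs (∈-lookup j))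
lookup-injective (x∉xs ∷ _) {fsuc i} {fzero}  e = contradiction (sym e) (lookupAll x∉xs (∈-lookup i))
lookup-injective (_     ∷ u) {fsuc i} {fsuc j} e = cong fsuc (lookup-injective u e)

unique-length≤ : ∀ {n} {xs : List (Fin n)} → Unique xs → length xs ≤ n
unique-length≤ {n} {xs} u with length xs ≤? n
... | yes ≤n = ≤n
... | no  ≰n with pigeonhole (≰⇒> ≰n) (lookupL xs)
...   | i , j , i<j , eq = contradiction i<j (<ᶠ-irrefl (lookup-injective u eq))

module _ {n} (G : SimpleGraph n) where

  open import Data.List.Membership.DecPropositional (_≟ᶠ_ {n}) using (_∈?_)

  walk-cons : ∀ {x y t ws} → Adj G x y → Walk G y t ws → Walk G x t (x ∷ ws)
  walk-cons {ws = y ∷ ws} xy (refl , ends , chain) = refl , ends , xy , chain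

  Path : Fin n → Fin n → List (Fin n) → Set
  Path a b ps = Walk G a b ps × Unique ps

  suffixAt : ∀ {x} (xs : List (Fin n)) → x ∈ xs → List (Fin n)
  suffixAt (y ∷ ys) (here _)  = y ∷ ys
  suffixAt (y ∷ ys) (there p) = suffixAt ys p

  suffixAt-path : ∀ {a x b} ps (x∈ : x ∈ ps) → Path a b ps → Path x b (suffixAt ps x∈)
  suffixAt-path (y ∷ ys)     (here refl) ((_ , ends , chain) , u) = (refl , ends , chain) , u
  suffixAt-path (y ∷ z ∷ zs) (there x∈)  ((_ , ends , _ , chain) , _ ∷ u) =
    suffixAt-path (z ∷ zs) x∈ ((refl , ends , chain) , u)

  prepend : ∀ {x y b ps} → Adj G x y → Path y b ps → ∃[ qs ] Path x b qs
  prepend {x} {ps = ps} xy path with x ∈? ps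
  ... | yes x∈ = suffixAt ps x∈ , suffixAt-path ps x∈ path
  ... | no  x∉ = x ∷ ps , walk-cons xy (proj₁ path) , ¬Any⇒All¬ ps x∉ ∷ proj₂ path

  shortcut : ∀ {a b} ws → Walk G a b ws → ∃[ ps ] Path a b ps
  shortcut (x ∷ [])     w@(refl , _)               = x ∷ [] , w , [] ∷ []
  shortcut (x ∷ y ∷ ys) (refl , ends , xy , chain) =
    prepend xy (proj₂ (shortcut (y ∷ ys) (refl , ends , chain)))

  -- Reachability of a fixed vertex t, decided by bounding the number of steps.
  module Reachability (t : Fin n) where

    ReachesWithin : ℕ → Fin n → Set
    ReachesWithin zero    x = x ≡ t
    ReachesWithin (suc k) x = ReachesWithin k x ⊎ ∃[ y ] (Adj G x y × ReachesWithin k y)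

    reachesWithin? : ∀ k x → Dec (ReachesWithin k x)
    reachesWithin? zero    x = x ≟ᶠ t
    reachesWithin? (suc k) x = reachesWithin? k x ⊎-dec any? λ y → dec G x y ×-dec reachesWithin? k y

    within⇒walk : ∀ k {x} → ReachesWithin k x → ∃[ ws ] Walk G x t ws
    within⇒walk zero    {x} refl                = x ∷ [] , refl , refl , tt
    within⇒walk (suc k)     (inj₁ r)            = within⇒walk k r
    within⇒walk (suc k) {x} (inj₂ (y , xy , r)) with within⇒walk k r
    ... | ws , w = x ∷ ws , walk-cons xy w

    walk⇒within : ∀ {x y} ws → Walk G x t (y ∷ ws) → ReachesWithin (length ws) x
    walk⇒within []       (refl , refl , _)          = refl
    walk⇒within (z ∷ ws) (refl , ends , xz , chain) =
      inj₂ (z , xz , walk⇒within ws (refl , ends , chain))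

    within-mono : ∀ {k l x} → k ≤ l → ReachesWithin k x → ReachesWithin l x
    within-mono k≤l = go (≤⇒≤′ k≤l)
      where
      go : ∀ {k l x} → k ≤′ l → ReachesWithin k x → ReachesWithin l x
      go ≤′-refl        r = r
      go (≤′-step k≤l) r = inj₁ (go k≤l r)

    -- Since paths have at most n vertices, n steps always suffice.
    Reaches : Fin n → Set
    Reaches = ReachesWithin n

    reaches? : ∀ x → Dec (Reaches x)
    reaches? = reachesWithin? n

    reaches-t : Reaches t
    reaches-t = within-mono z≤n refl

    reaches-walk : ∀ {x} → Reaches x → ∃[ ws ] Walk G x t ws
    reaches-walk = within⇒walk n

    reaches-step : ∀ {x y} → Adj G x y → Reaches y → Reaches x
    reaches-step xy r with reaches-walk r
    ... | ws , w with shortcut (_ ∷ ws) (walk-cons xy w)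
    ...   | _ ∷ ps , path , u = within-mono (<⇒≤ (unique-length≤ u)) (walk⇒within ps path)

    component : Fin n → Bool
    component x = does (reaches? x)

    component-edge : ∀ {x y} → Adj G x y → component x ≡ component y
    component-edge {x} {y} xy with reaches? x | reaches? y
    ... | yes _  | yes _  = refl
    ... | no  _  | no  _  = refl
    ... | yes rx | no ¬ry = contradiction (reaches-step (SimpleGraph.sym G xy) rx) ¬ry
    ... | no ¬rx | yes ry = contradiction (reaches-step xy ry) ¬rx

last∈ : ∀ {n} {b : Fin n} xs → last? xs b → b ∈ xs
last∈ (_ ∷ [])     refl = here refl
last∈ (_ ∷ x ∷ xs) l    = there (last∈ (x ∷ xs) l)

SameEdge : ∀ {n} → Fin n → Fin n → Fin n → Fin n → Set
SameEdge a b x y = (x ≡ a × y ≡ b) ⊎ (x ≡ b × y ≡ a)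

sameEdge? : ∀ {n} (a b x y : Fin n) → Dec (SameEdge a b x y)
sameEdge? a b x y = (x ≟ᶠ a ×-dec y ≟ᶠ b) ⊎-dec (x ≟ᶠ b ×-dec y ≟ᶠ a)

deleteEdge : ∀ {n} → SimpleGraph n → Fin n → Fin n → SimpleGraph n
deleteEdge G a b = record
  { Adj    = λ x y → Adj G x y × ¬ SameEdge a b x y
  ; sym    = λ (xy , ¬ab) → SimpleGraph.sym G xy , ¬ab ∘ flip
  ; irrefl = λ (xx , _) → irrefl G xx
  ; dec    = λ x y → dec G x y ×-dec ¬? (sameEdge? a b x y)
  }
  where
  flip : ∀ {x y} → SameEdge a b y x → SameEdge a b x y
  flip (inj₁ (ya , xb)) = inj₂ (xb , ya)
  flip (inj₂ (yb , xa)) = inj₁ (xa , yb)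

-- In an acyclic graph every edge ab is a bridge: no path of G - ab leads
-- from b back to a, since together with ab it would close a cycle.
acyclic-bridge : ∀ {n} {G : SimpleGraph n} {a b} → Acyclic G → Adj G a b →
  ∀ ps → ¬ Path (deleteEdge G a b) b a ps
acyclic-bridge {G = G} _ ab (_ ∷ [])     ((refl , refl , _) , _)           = irrefl G ab
acyclic-bridge         _ _  (_ ∷ _ ∷ []) ((refl , refl , (_ , ¬ab) , _) , _) = ¬ab (inj₂ (refl , refl))
acyclic-bridge {G = G} {a} {b} acyclic ab ps@(_ ∷ _ ∷ _ ∷ _) ((refl , ends , chain) , u) =
  acyclic ps (s≤s (s≤s (s≤s z≤n)) , u , forget ps chain , b , a , refl , ends , ab)
  where
  forget : ∀ ws → Chain (deleteEdge G a b) ws → Chain G ws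
  forget []           _              = tt
  forget (_ ∷ [])     _              = tt
  forget (_ ∷ y ∷ ws) ((xy , _) , c) = xy , forget (y ∷ ws) c

-- Coding vectors of a labelled graph on m + 1 vertices.

module Labelled {m} (σ : Labeling (suc m)) where

  label : Fin (suc m) → ℕ
  label u = toℕ (Bijection.to σ u)

  label≤m : ∀ u → label u ≤ m
  label≤m u = s≤s⁻¹ (toℕ<n (Bijection.to σ u))

  label-injective : ∀ {a b} → label a ≡ label b → a ≡ b
  label-injective eq = Bijection.injective σ (toℕ-injective eq)

  atDepth : ℕ → Fin (suc m)
  atDepth p = Surjection.to⁻ (Bijection.surjection σ) (fromℕ< (s≤s (m∸n≤m m p)))

  label-atDepth : ∀ p → label (atDepth p) ≡ m ∸ p
  label-atDepth p = trans (cong toℕ (Surjection.to∘to⁻ (Bijection.surjection σ) _)) (toℕ-fromℕ< _)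

  atDepth-label : ∀ a → atDepth (m ∸ label a) ≡ a
  atDepth-label a = label-injective (trans (label-atDepth (m ∸ label a)) (m∸[m∸n]≡n (label≤m a)))

  -- The vector of the vertex pair ab; for an edge it is f#(ab).
  edgeVec : Fin (suc m) → Fin (suc m) → Z2^ m
  edgeVec a b = threshold (label a) +V threshold (label b)

  edgeVec-comm : ∀ a b → edgeVec a b ≡ edgeVec b a
  edgeVec-comm a b = +V-comm (threshold (label a)) (threshold (label b))

  unit-edgeVec : ∀ (p : Fin m) → unit p ≡ edgeVec (atDepth (toℕ p)) (atDepth (suc (toℕ p)))
  unit-edgeVec p = trans (unit-threshold p)
    (sym (cong₂ (λ k l → threshold k +V threshold l)
                (label-atDepth (toℕ p)) (label-atDepth (suc (toℕ p)))))

  -- The cut functional of a vertex set C: a linear functional on ℤ₂^m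
  -- with cut C (edgeVec a b) = C a + C b.
  cutVector : (Fin (suc m) → Bool) → Z2^ m
  cutVector C = differences (C ∘ atDepth)

  cut : (Fin (suc m) → Bool) → Z2^ m → Bool
  cut C x = x · cutVector C

  cut-threshold : ∀ C a → cut C (threshold (label a)) ≡ C a xor C (atDepth m)
  cut-threshold C a =
    trans (telescope (m ∸ label a) (C ∘ atDepth) (m∸n≤m m (label a)))
          (cong (λ u → C u xor C (atDepth m)) (atDepth-label a))

  cut-edge : ∀ C a b → cut C (edgeVec a b) ≡ C a xor C b
  cut-edge C a b = begin
    cut C (edgeVec a b)
      ≡⟨ ·-+ (threshold (label a)) (threshold (label b)) (cutVector C) ⟩
    cut C (threshold (label a)) xor cut C (threshold (label b))
      ≡⟨ cong₂ _xor_ (cut-threshold C a) (cut-threshold C b) ⟩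
    (C a xor C₀) xor (C b xor C₀)
      ≡⟨ cong ((C a xor C₀) xor_) (xor-comm (C b) C₀) ⟩
    (C a xor C₀) xor (C₀ xor C b)
      ≡⟨ xor-cancel-middle (C a) C₀ (C b) ⟩
    C a xor C b
      ∎
    where
    C₀ : Bool
    C₀ = C (atDepth m)

  cut-balanced : ∀ C {a b} → C a ≡ C b → cut C (edgeVec a b) ≡ false
  cut-balanced C {a} {b} eq = trans (cut-edge C a b) (trans (cong (_xor C b) eq) (xor-same (C b)))

  cut-crossing : ∀ C {a b} → C a ≡ true → C b ≡ false → cut C (edgeVec a b) ≡ true
  cut-crossing C {a} {b} Ca Cb = trans (cut-edge C a b) (cong₂ _xor_ Ca Cb)

  cut-lincomb : ∀ C cs → cut C (lincomb cs) ≡ evaluate (cut C) cs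
  cut-lincomb C = ·-lincomb (cutVector C)

  -- Singleton cuts: an edge at x differs from every edge avoiding x.
  edgeVec-separates : ∀ {x y c d} → x ≢ y → x ≢ c → x ≢ d → edgeVec x y ≢ edgeVec c d
  edgeVec-separates {x} {y} {c} {d} x≢y x≢c x≢d eq = contradiction (begin
    true                   ≡⟨ sym (cut-crossing isX (dec-true (x ≟ᶠ x) refl) (dec-false (x ≟ᶠ y) x≢y)) ⟩
    cut isX (edgeVec x y)  ≡⟨ cong (cut isX) eq ⟩
    cut isX (edgeVec c d)  ≡⟨ cut-balanced isX (trans (dec-false (x ≟ᶠ c) x≢c)
                                                      (sym (dec-false (x ≟ᶠ d) x≢d))) ⟩
    false                  ∎) λ ()
    where
    isX : Fin (suc m) → Bool
    isX z = does (x ≟ᶠ z)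

  walkEdges : List (Fin (suc m)) → List (Bool × Z2^ m)
  walkEdges []           = []
  walkEdges (_ ∷ [])     = []
  walkEdges (x ∷ y ∷ ys) = (true , edgeVec x y) ∷ walkEdges (y ∷ ys)

  walkEdges-∈ : ∀ ws {v} → v ∈ mapL proj₂ (walkEdges ws) →
    ∃[ c ] ∃[ d ] (c ∈ ws × d ∈ ws × v ≡ edgeVec c d)
  walkEdges-∈ (x ∷ y ∷ ys) (here refl) = x , y , here refl , there (here refl) , refl
  walkEdges-∈ (x ∷ y ∷ ys) (there v∈) with walkEdges-∈ (y ∷ ys) v∈
  ... | c , d , c∈ , d∈ , eq = c , d , there c∈ , there d∈ , eq

  closing-edge-new : ∀ {a y b} rest → Unique (a ∷ y ∷ rest) → b ∈ rest →
    edgeVec b a ∉ mapL proj₂ (walkEdges (a ∷ y ∷ rest))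
  closing-edge-new {a} {y} {b} rest u@(_ ∷ u′) b∈rest (here eq) = edgeVec-separates b≢a b≢a b≢y eq
    where
    b≢a : b ≢ a
    b≢a b≡a = Unique[x∷xs]⇒x∉xs u (there (subst (_∈ rest) b≡a b∈rest))
    b≢y : b ≢ y
    b≢y b≡y = Unique[x∷xs]⇒x∉xs u′ (subst (_∈ rest) b≡y b∈rest)
  closing-edge-new {a} {y} {b} rest u b∈rest (there w∈) with walkEdges-∈ (y ∷ rest) w∈
  ... | c , d , c∈ , d∈ , eq =
    edgeVec-separates (a≢ (there b∈rest)) (a≢ c∈) (a≢ d∈) (trans (edgeVec-comm a b) eq)
    where
    a≢ : ∀ {c} → c ∈ y ∷ rest → a ≢ c
    a≢ c∈ a≡c = Unique[x∷xs]⇒x∉xs u (subst (_∈ y ∷ rest) (sym a≡c) c∈)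

  module _ (G : SimpleGraph (suc m)) where

    β : VSet m
    β = codingSeq G σ

    β⇒edge : ∀ {x} → β x → ∃[ a ] ∃[ b ] (Adj G a b × x ≡ edgeVec a b)
    β⇒edge (a , b , ab , b<a , refl) = a , b , ab , fSharp-threshold _ _ b<a

    edge⇒β : ∀ {a b} → Adj G a b → β (edgeVec a b)
    edge⇒β {a} {b} ab with <-cmp (label b) (label a)
    ... | tri< b<a _ _ = a , b , ab , b<a , sym (fSharp-threshold _ _ b<a)
    ... | tri≈ _ b≡a _ = contradiction (subst (Adj G a) (label-injective b≡a) ab) (irrefl G)
    ... | tri> _ _ a<b = b , a , SimpleGraph.sym G ab , a<b ,
                         trans (edgeVec-comm a b) (sym (fSharp-threshold _ _ a<b))

    walkEdges-β : ∀ ws → Chain G ws → All β (mapL proj₂ (walkEdges ws))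
    walkEdges-β []           _          = []
    walkEdges-β (_ ∷ [])     _          = []
    walkEdges-β (x ∷ y ∷ ys) (xy , chain) = edge⇒β xy ∷ walkEdges-β (y ∷ ys) chain

    walkEdges-sum : ∀ {a b} ws → Walk G a b ws → lincomb (walkEdges ws) ≡ edgeVec a b
    walkEdges-sum (x ∷ [])         (refl , refl , _)        = sym (+V-self (threshold (label x)))
    walkEdges-sum {b = b} (x ∷ y ∷ ys) (refl , ends , _ , chain) = begin
      (true • edgeVec x y) +V lincomb (walkEdges (y ∷ ys))
        ≡⟨ cong₂ _+V_ (•-identity (edgeVec x y)) (walkEdges-sum (y ∷ ys) (refl , ends , chain)) ⟩
      edgeVec x y +V edgeVec y b
        ≡⟨ +V-cancel-middle (threshold (label x)) (threshold (label y)) (threshold (label b)) ⟩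
      edgeVec x b
        ∎

    walkEdges-unique : ∀ ws → Chain G ws → Unique ws → Unique (mapL proj₂ (walkEdges ws))
    walkEdges-unique []           _            _          = []
    walkEdges-unique (_ ∷ [])     _            _          = []
    walkEdges-unique (x ∷ y ∷ ys) (xy , chain) (x∉ ∷ u) =
      ¬Any⇒All¬ _ new ∷ walkEdges-unique (y ∷ ys) chain u
      where
      new : edgeVec x y ∉ mapL proj₂ (walkEdges (y ∷ ys))
      new v∈ with walkEdges-∈ (y ∷ ys) v∈
      ... | c , d , c∈ , d∈ , eq =
        edgeVec-separates (λ { refl → irrefl G xy }) (λ { refl → lookupAll x∉ c∈ refl })
                          (λ { refl → lookupAll x∉ d∈ refl }) eq

    -- A connected graph: every unit vector is the edgeVec of two vertices,
    -- which a walk between them writes as a sum of edges.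
    connected⇒spans : Connected G → Spans β
    connected⇒spans connected = units-span β λ p →
      subst (InSpan β) (sym (unit-edgeVec p)) (edgeVec-inSpan (atDepth (toℕ p)) (atDepth (suc (toℕ p))))
      where
      edgeVec-inSpan : ∀ a b → InSpan β (edgeVec a b)
      edgeVec-inSpan a b with connected a b
      ... | ws , walk@(_ , _ , chain) = walkEdges ws , walkEdges-β ws chain , walkEdges-sum ws walk

    cut-span-vanishes : ∀ C → (∀ {x y} → Adj G x y → C x ≡ C y) →
      ∀ {w} → InSpan β w → cut C w ≡ false
    cut-span-vanishes C closed (cs , cs∈β , refl) =
      trans (cut-lincomb C cs) (evaluate-vanishing (cut C) cs λ w∈ → vanishes (lookupAll cs∈β w∈))
      where
      vanishes : ∀ {w} → β w → cut C w ≡ false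
      vanishes w∈β with β⇒edge w∈β
      ... | _ , _ , xy , refl = cut-balanced C (closed xy)

    -- If u cannot reach v, the cut of the component of v is 1 at
    -- edgeVec v u, so edgeVec v u is not in the span of β.
    spans⇒connected : Spans β → Connected G
    spans⇒connected spans u v with Reachability.reaches? G v u
    ... | yes reach = Reachability.reaches-walk G v reach
    ... | no ¬reach =
      contradiction (trans (sym crossing) (cut-span-vanishes component component-edge (spans (edgeVec v u))))
                    λ ()
      where
      open Reachability G v
      crossing : cut component (edgeVec v u) ≡ true
      crossing = cut-crossing component (dec-true (reaches? v) reaches-t) (dec-false (reaches? u) ¬reach)

    cycle-sum : ∀ {a b} ws → Walk G a b ws → lincomb ((true , edgeVec b a) ∷ walkEdges ws) ≡ zeroV
    cycle-sum {a} {b} ws walk = begin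
      (true • edgeVec b a) +V lincomb (walkEdges ws)
        ≡⟨ cong₂ _+V_ (•-identity (edgeVec b a)) (walkEdges-sum ws walk) ⟩
      edgeVec b a +V edgeVec a b
        ≡⟨ +V-cancel-middle (threshold (label b)) (threshold (label a)) (threshold (label b)) ⟩
      edgeVec b b
        ≡⟨ +V-self (threshold (label b)) ⟩
      zeroV
        ∎

    -- A cycle gives a vanishing combination of distinct vectors of β with
    -- all coefficients 1.
    independent⇒acyclic : LinearlyIndependent β → Acyclic G
    independent⇒acyclic _ []                 (() , _)
    independent⇒acyclic _ (_ ∷ [])           (s≤s () , _)
    independent⇒acyclic _ (_ ∷ _ ∷ [])       (s≤s (s≤s ()) , _)
    independent⇒acyclic independent cycle@(a ∷ y ∷ rest@(_ ∷ _))
                        (_ , u , chain , _ , b , refl , ends , ba) =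
      contradiction (All.head (independent cs distinct inβ (cycle-sum cycle (refl , ends , chain)))) λ ()
      where
      cs : List (Bool × Z2^ m)
      cs = (true , edgeVec b a) ∷ walkEdges cycle

      distinct : Unique (mapL proj₂ cs)
      distinct = ¬Any⇒All¬ _ (closing-edge-new rest u (last∈ rest ends))
               ∷ walkEdges-unique cycle chain u

      inβ : All β (mapL proj₂ cs)
      inβ = edge⇒β ba ∷ walkEdges-β cycle chain

    -- In a tree, the component C of a in G - ab satisfies C a = 1, C b = 0,
    -- and C x = C y for every other edge xy: its cut detects exactly f#(ab).
    module EdgeCut (tree : IsTree G) {a b} (ab : Adj G a b) where
      open Reachability (deleteEdge G a b) a public

      component-a : component a ≡ true
      component-a = dec-true (reaches? a) reaches-t

      component-b : component b ≡ false
      component-b = dec-false (reaches? b) λ reach →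
        let ws , walk = reaches-walk reach
            ps , path = shortcut (deleteEdge G a b) ws walk
        in  acyclic-bridge (proj₂ tree) ab ps path

      detects : ∀ {x y} → Adj G x y → cut component (edgeVec x y) ≡ true → edgeVec x y ≡ edgeVec a b
      detects {x} {y} xy cut≡1 with sameEdge? a b x y
      ... | yes (inj₁ (refl , refl)) = refl
      ... | yes (inj₂ (refl , refl)) = edgeVec-comm b a
      ... | no  ¬ab =
        contradiction (trans (sym cut≡1) (cut-balanced component (component-edge (xy , ¬ab)))) λ ()

    -- The coefficient of each f#(ab) in a vanishing combination is the
    -- value of the cut of EdgeCut at the combination, i.e. 0.
    tree⇒independent : IsTree G → LinearlyIndependent β
    tree⇒independent tree cs distinct inβ sum≡0 = All.tabulate coefficient-zero
      where
      coefficient-zero : ∀ {p} → p ∈ cs → proj₁ p ≡ false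
      coefficient-zero {c , v} cv∈ with β⇒edge (lookupAll inβ (∈-map⁺ proj₂ cv∈))
      ... | a , b , ab , refl = begin
        c                              ≡⟨ sym (evaluate-isolates (cut component) cs distinct cv∈
                                                 (cut-crossing component component-a component-b) only-ab) ⟩
        evaluate (cut component) cs    ≡⟨ sym (cut-lincomb component cs) ⟩
        cut component (lincomb cs)     ≡⟨ cong (cut component) sum≡0 ⟩
        cut component zeroV            ≡⟨ ·-zeroˡ (cutVector component) ⟩
        false                          ∎
        where
        open EdgeCut tree ab
        only-ab : ∀ {w} → w ∈ mapL proj₂ cs → cut component w ≡ true → w ≡ edgeVec a b
        only-ab w∈ cut≡1 with β⇒edge (lookupAll inβ w∈)
        ... | _ , _ , xy , refl = detects xy cut≡1

-- The theorem.  The converse direction only needs one labeling; we use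
-- the identity.

theorem1 : (n : ℕ) → 1 ≤ n → (G : SimpleGraph n) →
    ((IsTree G → (σ : Labeling n) → IsBasis (codingSeq G σ)) ×
     (((σ : Labeling n) → IsBasis (codingSeq G σ)) → IsTree G))
theorem1 (suc m) _ G = every-basis , from-basis
  where
  every-basis : IsTree G → (σ : Labeling (suc m)) → IsBasis (codingSeq G σ)
  every-basis tree σ = Labelled.tree⇒independent σ G tree , Labelled.connected⇒spans σ G (proj₁ tree)

  from-basis : ((σ : Labeling (suc m)) → IsBasis (codingSeq G σ)) → IsTree G
  from-basis basis = Labelled.spans⇒connected identity G (proj₂ (basis identity)) ,
                     Labelled.independent⇒acyclic identity G (proj₁ (basis identity))
    where
    identity : Labeling (suc m)
    identity = ⤖-id (Fin (suc m))
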